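{- If a graph $G$ has no alternating cycle, then $G$ is a leaf power.
   Context: All graphs are finite and simple. A sequence $C=(x_0,y_0,x_1,y_1,\dots,x_{c-1},y_{c-1})$ of $2c$ distinct vertices of $G$ ($c\ge 1$) is an alternating cycle if for each $i\in\{0,\dots,c-1\}$, $x_iy_i\in E(G)$ and $y_ix_{i+1}\notin E(G)$ (indices modulo $c$). A graph $G$ is a leaf power if there exist a tree $T$ whose leaf set is exactly $V(G)$ and a positive integer $k$ such that for all distinct $u,v\in V(G)$, $uv\in E(G)$ iff the distance between $u$ and $v$ in $T$ is at most $k$. -}

module Defs where

open import Data.Nat using (ℕ; zero; suc; _≤_; _%_)
open import Data.Nat.DivMod using (m%n<n)
open import Data.Fin using (Fin; toℕ; fromℕ<)
open import Data.Bool using (Bool; true; false)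
open import Data.Product using (Σ; _×_; ∃)
open import Relation.Binary.PropositionalEquality using (_≡_; _≢_)
open import Relation.Nullary using (¬_)
open import Function.Definitions using (Injective)
open import Function.Bundles using (_⇔_)

record Graph (n : ℕ) : Set where
  field
    adj    : Fin n → Fin n → Bool
    sym    : ∀ u v → adj u v ≡ adj v u
    irrefl : ∀ v → adj v v ≡ false
open Graph public

next : ∀ {k} → Fin (suc k) → Fin (suc k)
next {k} i = fromℕ< (m%n<n (suc (toℕ i)) (suc k))

record AlternatingCycle {n} (G : Graph n) (c' : ℕ) : Set where
  field
    x y      : Fin (suc c') → Fin n
    x-inj    : Injective _≡_ _≡_ x
    y-inj    : Injective _≡_ _≡_ y
    x≢y      : ∀ i j → x i ≢ y j
    edge     : ∀ i → adj G (x i) (y i) ≡ true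
    nonedge  : ∀ i → adj G (y i) (x (next i)) ≡ false

HasAlternatingCycle : ∀ {n} → Graph n → Set
HasAlternatingCycle G = ∃ λ c' → AlternatingCycle G c'

data Walk {m} (T : Graph m) : Fin m → Fin m → ℕ → Set where
  here : ∀ {a} → Walk T a a 0
  step : ∀ {a b c ℓ} → adj T a b ≡ true → Walk T b c ℓ → Walk T a c (suc ℓ)

Connected : ∀ {m} → Graph m → Set
Connected T = ∀ a b → ∃ λ ℓ → Walk T a b ℓ

record Cycle {m} (T : Graph m) (l' : ℕ) : Set where
  field
    long : 2 ≤ l'
    v    : Fin (suc l') → Fin m
    inj  : Injective _≡_ _≡_ v
    adjs : ∀ i → adj T (v i) (v (next i)) ≡ true

Acyclic : ∀ {m} → Graph m → Set
Acyclic T = ∀ l' → ¬ Cycle T l'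

IsTree : ∀ {m} → Graph m → Set
IsTree T = Connected T × Acyclic T

-- leaf: vertex of degree at most 1 (no two distinct neighbours)
IsLeaf : ∀ {m} → Graph m → Fin m → Set
IsLeaf T v = ∀ a b → adj T v a ≡ true → adj T v b ≡ true → a ≡ b

-- dist_T(a,b) ≤ k  iff  some walk from a to b has length ≤ k
DistLe : ∀ {m} → Graph m → Fin m → Fin m → ℕ → Set
DistLe T a b k = ∃ λ ℓ → ℓ ≤ k × Walk T a b ℓ

IsLeafPower : ∀ {n} → Graph n → Set
IsLeafPower {n} G =
  Σ ℕ λ m → Σ (Graph m) λ T → Σ (Fin n → Fin m) λ f →
    IsTree T × Injective _≡_ _≡_ f
    × (∀ t → IsLeaf T t ⇔ ∃ λ u → f u ≡ t)
    × Σ ℕ λ k → 1 ≤ k ×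
      (∀ u v → u ≢ v → (adj G u v ≡ true) ⇔ DistLe T (f u) (f v) k)

module Submission where

-- Forbidding just the alternating cycles of length 2 already makes
-- neighbourhoods nested: a ∈ N(u) ∖ N[v] and b ∈ N(v) ∖ {u} force b ∈ N(u).
-- In a nested graph a vertex of maximum degree is either dominating, or
-- some non-neighbour of it is isolated (a degree count via a transposition).
-- Deleting such a pivot vertex and recursing shows that G is a threshold
-- graph: there are weights w and a bound t with uv ∈ E ⇔ w u + w v ≤ t.
-- Finally a threshold graph on at least two vertices is the (t + 2)-leaf
-- power of the spider with one leg of length w u + 1 ending in a leaf u,
-- since two such leaves are at distance (w u + 1) + (w v + 1).

open import Defs
open import Data.Nat using (ℕ; zero; suc; _+_; _∸_; _%_; _≤_; _<_; z≤n; s≤s)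
open import Data.Nat.DivMod using (m<n⇒m%n≡m; n%n≡0)
open import Data.Nat.Properties
  using ( ≤-refl; ≤-trans; ≤-reflexive; ≤-pred; <-irrefl; <⇒≱; n≤1+n; n<1+n; m<n⇒m<1+n
        ; m≤n⇒m<n∨m≡n; m≤m+n; m≤n+m; 1+n≰n; 1+n≢n; 1+n≢0; suc-injective
        ; +-comm; +-suc; +-identityʳ; +-mono-≤; +-mono-≤-<; +-monoˡ-≤; +-cancelʳ-≤
        ; m<n⇒0<n∸m; n∸n≡0; +-∸-assoc; module ≤-Reasoning
        ; +-0-commutativeMonoid; +-commutativeSemigroup )
open import Data.Fin
  using (Fin; zero; suc; toℕ; fromℕ; fromℕ<; inject₁; punchIn; punchOut; _↑ˡ_; _↑ʳ_; splitAt)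
open import Data.Fin.Properties
  using ( _≟_; any?; toℕ-injective; toℕ<n; toℕ-fromℕ; toℕ-fromℕ<; toℕ-inject₁
        ; punchIn-injective; punchInᵢ≢i; punchIn-punchOut; splitAt-↑ˡ; splitAt-↑ʳ; join-splitAt )
open import Data.Fin.Permutation using (transpose)
import Data.Fin.Permutation.Components as Components
open import Data.Vec.Functional using (insertAt)
open import Data.Vec.Functional.Properties using (insertAt-lookup; insertAt-punchIn)
open import Data.List using (allFin)
open import Data.List.Relation.Unary.All using (lookup)
open import Data.List.Membership.Propositional.Properties using (∈-allFin)
open import Data.List.Extrema.Nat using (argmax; f[xs]≤f[argmax])
open import Algebra.Properties.CommutativeMonoid.Sum +-0-commutativeMonoid
  using (sum; sum-permute)
open import Data.Bool using (Bool; true; false; if_then_else_; _∨_)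
open import Data.Bool.Properties using (∨-comm) renaming (_≟_ to _≟ᵇ_)
open import Data.Maybe using (Maybe; just; nothing)
import Data.Maybe as Maybe using (map)
open import Data.Maybe.Properties using (just-injective; ≡-dec)
open import Data.Product using (Σ; ∃; _×_; _,_; uncurry)
import Data.Product as Product
open import Data.Sum using (_⊎_; inj₁; inj₂)
import Data.Sum as Sum using (swap)
open import Data.Empty using (⊥; ⊥-elim)
open import Relation.Nullary using (¬_; Dec; does; yes; no)
open import Relation.Nullary.Decidable using (dec-true; dec-false; ¬?; _×-dec_)
open import Relation.Binary.PropositionalEquality
  using (_≡_; _≢_; refl; trans; cong; cong₂; subst) renaming (sym to ≡-sym)
open import Function using (_∘_; id)
open import Function.Definitions using (Injective)
open import Function.Bundles using (_⇔_; mk⇔)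
open import Function.Properties.Equivalence
  using () renaming (trans to ⇔-trans; sym to ⇔-sym)
open import Algebra.Properties.CommutativeSemigroup +-commutativeSemigroup
  using (interchange)

true≢false : true ≢ false
true≢false ()

adj⇒≢ : ∀ {n} (G : Graph n) {u v} → adj G u v ≡ true → u ≢ v
adj⇒≢ G {u} uv refl = true≢false (trans (≡-sym uv) (irrefl G u))

maximiser : ∀ {k} (f : Fin (suc k) → ℕ) → Σ (Fin (suc k)) λ i → ∀ j → f j ≤ f i
maximiser f = argmax f zero (allFin _) ,
  λ j → lookup (f[xs]≤f[argmax] {f = f} zero (allFin _)) (∈-allFin j)

pair : ∀ {A : Set} → A → A → Fin 2 → A
pair x y zero = x
pair x y (suc zero) = y

pair-injective : ∀ {A : Set} {x y : A} → x ≢ y → Injective _≡_ _≡_ (pair x y)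
pair-injective x≢y {zero} {zero} _ = refl
pair-injective x≢y {zero} {suc zero} x≡y = ⊥-elim (x≢y x≡y)
pair-injective x≢y {suc zero} {zero} y≡x = ⊥-elim (x≢y (≡-sym y≡x))
pair-injective x≢y {suc zero} {suc zero} _ = refl

-- An alternating cycle of length 2: edges ua, vb and non-edges av, bu.
-- Only a ≠ v and b ≠ u must be assumed; the other distinctness conditions
-- follow from the edge pattern.
alternatingSquare : ∀ {n} (G : Graph n) {u a v b : Fin n} → a ≢ v → b ≢ u →
  adj G u a ≡ true → adj G v b ≡ true → adj G a v ≡ false → adj G b u ≡ false →
  HasAlternatingCycle G
alternatingSquare G {u} {a} {v} {b} a≢v b≢u ua vb av bu = 1 , record
  { x = pair u v ; y = pair a b
  ; x-inj = pair-injective u≢v ; y-inj = pair-injective a≢b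
  ; x≢y = x≢y ; edge = edge ; nonedge = nonedge }
  where
  u≢v : u ≢ v
  u≢v refl = true≢false (trans (≡-sym ua) (trans (sym G u a) av))
  a≢b : a ≢ b
  a≢b refl = true≢false (trans (≡-sym ua) (trans (sym G u a) bu))
  x≢y : ∀ i j → pair u v i ≢ pair a b j
  x≢y zero zero = adj⇒≢ G ua
  x≢y zero (suc zero) u≡b = b≢u (≡-sym u≡b)
  x≢y (suc zero) zero v≡a = a≢v (≡-sym v≡a)
  x≢y (suc zero) (suc zero) = adj⇒≢ G vb
  edge : ∀ i → adj G (pair u v i) (pair a b i) ≡ true
  edge zero = ua
  edge (suc zero) = vb
  nonedge : ∀ i → adj G (pair a b i) (pair u v (next i)) ≡ false
  nonedge zero = av
  nonedge (suc zero) = bu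

-- Nested neighbourhoods: if a ∈ N(u) ∖ N[v], then every neighbour b ≠ u
-- of v is a neighbour of u.  (Equivalently: no alternating cycle of length 2.)
Nested : ∀ {n} → Graph n → Set
Nested G = ∀ {u v a b} → adj G u a ≡ true → adj G a v ≡ false → a ≢ v →
  adj G v b ≡ true → b ≢ u → adj G b u ≡ true

nested : ∀ {n} (G : Graph n) → ¬ HasAlternatingCycle G → Nested G
nested G noCycle {u} {v} {a} {b} ua av a≢v vb b≢u with adj G b u in bu
... | true = refl
... | false = ⊥-elim (noCycle (alternatingSquare G a≢v b≢u ua vb av bu))

indicator : Bool → ℕ
indicator b = if b then 1 else 0

count : ∀ {n} → (Fin n → Bool) → ℕ
count p = sum (λ a → indicator (p a))

deg : ∀ {n} → Graph n → Fin n → ℕ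
deg G u = count (adj G u)

indicator-mono : ∀ {b c} → (b ≡ true → c ≡ true) → indicator b ≤ indicator c
indicator-mono {false} _ = z≤n
indicator-mono {true} b⇒c rewrite b⇒c refl = ≤-refl

count-mono : ∀ {n} (p q : Fin n → Bool) → (∀ a → p a ≡ true → q a ≡ true) →
  count p ≤ count q
count-mono {zero} p q p⇒q = z≤n
count-mono {suc n} p q p⇒q =
  +-mono-≤ (indicator-mono (p⇒q zero)) (count-mono (p ∘ suc) (q ∘ suc) (p⇒q ∘ suc))

count-< : ∀ {n} (p q : Fin n → Bool) → (∀ a → p a ≡ true → q a ≡ true) →
  ∀ x → p x ≡ false → q x ≡ true → count p < count q
count-< p q p⇒q zero px qx rewrite px | qx =
  s≤s (count-mono (p ∘ suc) (q ∘ suc) (p⇒q ∘ suc))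
count-< p q p⇒q (suc x) px qx =
  +-mono-≤-< (indicator-mono (p⇒q zero)) (count-< (p ∘ suc) (q ∘ suc) (p⇒q ∘ suc) x px qx)

transpose-i : ∀ {n} (i j : Fin n) → Components.transpose i j i ≡ j
transpose-i i j rewrite dec-true (i ≟ i) refl = refl

transpose-j : ∀ {n} {i j : Fin n} → j ≢ i → Components.transpose i j j ≡ i
transpose-j {i = i} {j} j≢i rewrite dec-false (j ≟ i) j≢i | dec-true (j ≟ j) refl = refl

transpose-other : ∀ {n} {i j k : Fin n} → k ≢ i → k ≢ j → Components.transpose i j k ≡ k
transpose-other {i = i} {j} {k} k≢i k≢j
  rewrite dec-false (k ≟ i) k≢i | dec-false (k ≟ j) k≢j = refl

-- In a nested graph, if y has a neighbour x ≠ w that is not a neighbour of w,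
-- then deg w < deg y: the transposition (w y) maps N(w) into N(y) ∖ {x}.
degree-< : ∀ {n} (G : Graph n) → Nested G → ∀ {w x y} →
  adj G y x ≡ true → adj G w x ≡ false → x ≢ w → deg G w < deg G y
degree-< G nest {w} {x} {y} yx wx x≢w =
  subst (_< deg G y) (≡-sym (sum-permute (λ a → indicator (adj G w a)) (transpose w y)))
    (count-< (λ a → adj G w (τ a)) (adj G y) into x wτx yx)
  where
  τ : Fin _ → Fin _
  τ = Components.transpose w y
  x≢y : x ≢ y
  x≢y x≡y = adj⇒≢ G yx (≡-sym x≡y)
  into : ∀ a → adj G w (τ a) ≡ true → adj G y a ≡ true
  into a = by-cases (a ≟ w) (a ≟ y)
    where
    by-cases : Dec (a ≡ w) → Dec (a ≡ y) → adj G w (τ a) ≡ true → adj G y a ≡ true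
    by-cases (yes refl) _ wτa rewrite transpose-i a y = trans (sym G y a) wτa
    by-cases (no a≢w) (yes refl) wτa rewrite transpose-j a≢w = ⊥-elim (adj⇒≢ G wτa refl)
    by-cases (no a≢w) (no a≢y) wτa rewrite transpose-other a≢w a≢y =
      trans (sym G y a) (nest yx (trans (sym G x w) wx) x≢w wτa a≢y)
  wτx : adj G w (τ x) ≡ false
  wτx rewrite transpose-other x≢w x≢y = wx

data Pivot {n} (G : Graph n) : Set where
  isolated   : (z : Fin n) → (∀ v → adj G z v ≡ false) → Pivot G
  dominating : (z : Fin n) → (∀ v → v ≢ z → adj G z v ≡ true) → Pivot G

-- Every non-empty nested graph has a pivot: a vertex w of maximum degree is
-- dominating, unless some x ≠ w is not adjacent to w; then x is isolated,
-- since a neighbour y of x would have deg w < deg y by degree-<.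
pivot : ∀ {k} (G : Graph (suc k)) → Nested G → Pivot G
pivot G nest = from-maximum (maximiser (deg G))
  where
  from-maximum : (Σ (Fin _) λ w → ∀ y → deg G y ≤ deg G w) → Pivot G
  from-maximum (w , maximal) = by-cases (any? (λ x → ¬? (x ≟ w) ×-dec (adj G w x ≟ᵇ false)))
    where
    by-cases : Dec (∃ λ x → x ≢ w × adj G w x ≡ false) → Pivot G
    by-cases (yes (x , x≢w , wx)) = isolated x x-isolated
      where
      x-isolated : ∀ y → adj G x y ≡ false
      x-isolated y with adj G x y in xy
      ... | false = refl
      ... | true = ⊥-elim (<⇒≱ (degree-< G nest (trans (sym G y x) xy) wx x≢w) (maximal y))
    by-cases (no no-non-neighbour) = dominating w w-dominating
      where
      w-dominating : ∀ v → v ≢ w → adj G w v ≡ true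
      w-dominating v v≢w with adj G w v in wv
      ... | true = refl
      ... | false = ⊥-elim (no-non-neighbour (v , v≢w , wv))

-- Weights are normalised to be at most
-- bound + 1 (larger weights carry no extra information).
record Threshold {n} (G : Graph n) : Set where
  field
    weight    : Fin n → ℕ
    bound     : ℕ
    weight-≤  : ∀ v → weight v ≤ suc bound
    adjacency : ∀ u v → u ≢ v → (adj G u v ≡ true) ⇔ (weight u + weight v ≤ bound)

delete : ∀ {n} → Graph (suc n) → Fin (suc n) → Graph n
delete G z = record
  { adj = λ a b → adj G (punchIn z a) (punchIn z b)
  ; sym = λ a b → sym G (punchIn z a) (punchIn z b)
  ; irrefl = λ a → irrefl G (punchIn z a) }

nested-delete : ∀ {n} (G : Graph (suc n)) (z : Fin (suc n)) → Nested G → Nested (delete G z)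
nested-delete G z nest ua av a≢v vb b≢u =
  nest ua av (a≢v ∘ punchIn-injective z _ _) vb (b≢u ∘ punchIn-injective z _ _)

punchIn-view : ∀ {n} (z v : Fin (suc n)) → v ≡ z ⊎ ∃ λ a → punchIn z a ≡ v
punchIn-view z v with v ≟ z
... | yes v≡z = inj₁ v≡z
... | no v≢z = inj₂ (punchOut (v≢z ∘ ≡-sym) , punchIn-punchOut _)

extend : ∀ {n} (G : Graph (suc n)) (z : Fin (suc n)) (R : Threshold (delete G z)) →
  let open Threshold R in (c : ℕ) → c ≤ suc bound →
  (∀ a → (adj G z (punchIn z a) ≡ true) ⇔ (c + weight a ≤ bound)) → Threshold G
extend G z R c c≤ z-adjacency = record
  { weight = weight′ ; bound = bound ; weight-≤ = weight′-≤ ; adjacency = adjacency′ }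
  where
  open Threshold R
  weight′ : Fin _ → ℕ
  weight′ = insertAt weight z c
  weight′-≤ : ∀ v → weight′ v ≤ suc bound
  weight′-≤ v with punchIn-view z v
  ... | inj₁ refl rewrite insertAt-lookup weight z c = c≤
  ... | inj₂ (a , refl) rewrite insertAt-punchIn weight z c a = weight-≤ a
  adjacency′ : ∀ u v → u ≢ v → (adj G u v ≡ true) ⇔ (weight′ u + weight′ v ≤ bound)
  adjacency′ u v u≢v with punchIn-view z u | punchIn-view z v
  ... | inj₁ refl | inj₁ refl = ⊥-elim (u≢v refl)
  ... | inj₁ refl | inj₂ (b , refl)
    rewrite insertAt-lookup weight z c | insertAt-punchIn weight z c b = z-adjacency b
  ... | inj₂ (a , refl) | inj₁ refl
    rewrite insertAt-lookup weight z c | insertAt-punchIn weight z c a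
          | sym G (punchIn z a) z | +-comm (weight a) c = z-adjacency a
  ... | inj₂ (a , refl) | inj₂ (b , refl)
    rewrite insertAt-punchIn weight z c a | insertAt-punchIn weight z c b =
    adjacency a b (u≢v ∘ cong (punchIn z))

shift-⇔ : ∀ a b t s → (a + b ≤ t) ⇔ ((a + s) + (b + s) ≤ t + (s + s))
shift-⇔ a b t s rewrite interchange a s b s =
  mk⇔ (+-monoˡ-≤ (s + s)) (+-cancelʳ-≤ (s + s) (a + b) t)

-- Raising every weight by s = bound + 1 and the bound by 2s preserves a
-- threshold representation (raise); afterwards every weight is at most the
-- bound (raised-≤), so a new vertex of weight 0 is adjacent to all others.
raised-≤ : ∀ {n} {G : Graph n} (R : Threshold G) → let open Threshold R in
  ∀ v → weight v + suc bound ≤ bound + (suc bound + suc bound)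
raised-≤ R v = ≤-trans (+-monoˡ-≤ (suc bound) (weight-≤ v)) (m≤n+m _ bound)
  where open Threshold R

raise : ∀ {n} {G : Graph n} → Threshold G → Threshold G
raise R = record
  { weight = λ v → weight v + suc bound
  ; bound = bound + (suc bound + suc bound)
  ; weight-≤ = λ v → ≤-trans (raised-≤ R v) (n≤1+n _)
  ; adjacency = λ u v u≢v →
      ⇔-trans (adjacency u v u≢v) (shift-⇔ (weight u) (weight v) bound (suc bound)) }
  where open Threshold R

-- Every nested graph has a threshold representation, by induction on the
-- number of vertices: delete a pivot z, represent G − z, and give z weight
-- bound + 1 if it is isolated, or weight 0 after raising if it is dominating.
threshold : ∀ n (G : Graph n) → Nested G → Threshold G
threshold zero G nest = record { weight = λ () ; bound = 0 ; weight-≤ = λ () ; adjacency = λ () }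
threshold (suc n) G nest = from-pivot (pivot G nest)
  where
  rest : ∀ z → Threshold (delete G z)
  rest z = threshold n (delete G z) (nested-delete G z nest)
  from-pivot : Pivot G → Threshold G
  from-pivot (isolated z z-isolated) =
    extend G z (rest z) (suc bound) ≤-refl λ a →
      mk⇔ (λ za → ⊥-elim (true≢false (trans (≡-sym za) (z-isolated (punchIn z a)))))
          (λ too-heavy → ⊥-elim (1+n≰n (≤-trans (m≤m+n (suc bound) (weight a)) too-heavy)))
    where open Threshold (rest z)
  from-pivot (dominating z z-dominating) =
    extend G z (raise (rest z)) 0 z≤n λ a →
      mk⇔ (λ _ → raised-≤ (rest z) a) (λ _ → z-dominating (punchIn z a) (punchInᵢ≢i z a))

_++ʷ_ : ∀ {m} {T : Graph m} {a b c k ℓ} → Walk T a b k → Walk T b c ℓ → Walk T a c (k + ℓ)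
here ++ʷ w′ = w′
step e w ++ʷ w′ = step e (w ++ʷ w′)

snocʷ : ∀ {m} {T : Graph m} {a b c ℓ} → Walk T a b ℓ → adj T b c ≡ true → Walk T a c (suc ℓ)
snocʷ here e = step e here
snocʷ (step e′ w) e = step e′ (snocʷ w e)

reverseʷ : ∀ {m} {T : Graph m} {a b ℓ} → Walk T a b ℓ → Walk T b a ℓ
reverseʷ here = here
reverseʷ {T = T} {a} (step {b = b} e w) = snocʷ (reverseʷ w) (trans (sym T b a) e)

-- A potential that drops by at most one along each edge bounds walk lengths
-- from below: this is how lower bounds on distances are proved.
potential-bound : ∀ {m} (T : Graph m) (D : Fin m → ℕ) →
  (∀ a b → adj T a b ≡ true → D a ≤ suc (D b)) →
  ∀ {a b ℓ} → Walk T a b ℓ → D a ≤ ℓ + D b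
potential-bound T D drop here = ≤-refl
potential-bound T D drop (step {a = a} {b} e w) =
  ≤-trans (drop a b e) (s≤s (potential-bound T D drop w))

next-view : ∀ {k} (i : Fin (suc k)) →
  (toℕ i < k × toℕ (next i) ≡ suc (toℕ i)) ⊎ (toℕ i ≡ k × toℕ (next i) ≡ 0)
next-view {k} i with m≤n⇒m<n∨m≡n (≤-pred (toℕ<n i))
... | inj₁ i<k = inj₁ (i<k , trans (toℕ-fromℕ< _) (m<n⇒m%n≡m (s≤s i<k)))
... | inj₂ i≡k =
  inj₂ (i≡k , trans (toℕ-fromℕ< _) (subst (λ t → suc t % suc k ≡ 0) (≡-sym i≡k) (n%n≡0 (suc k))))

next-surjective : ∀ {k} (i : Fin (suc k)) → ∃ λ j → next j ≡ i
next-surjective {k} zero with next-view (fromℕ k)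
... | inj₁ (k<k , _) = ⊥-elim (<-irrefl (toℕ-fromℕ k) k<k)
... | inj₂ (_ , wraps) = fromℕ k , toℕ-injective wraps
next-surjective {suc k} (suc i) with next-view (inject₁ i)
... | inj₁ (_ , increments) = inject₁ i , toℕ-injective (trans increments (cong suc (toℕ-inject₁ i)))
... | inj₂ (i≡k , _) = ⊥-elim (<-irrefl (trans (≡-sym (toℕ-inject₁ i)) i≡k) (toℕ<n i))

-- On a cycle of length at least 3, stepping twice never returns: according
-- to whether j and next j increment or wrap, returning would force
-- j + 2 ≡ j, or k ≡ 1, or k ≡ 1, or k ≡ 0.
next-next≢ : ∀ {k} → 2 ≤ k → (j : Fin (suc k)) → next (next j) ≢ j
next-next≢ {k} 2≤k j back with next-view j | next-view (next j) | cong toℕ back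
... | inj₁ (_ , p) | inj₁ (_ , q) | r =
  <-irrefl (≡-sym (trans (≡-sym (trans q (cong suc p))) r)) (m<n⇒m<1+n (n<1+n (toℕ j)))
... | inj₁ (_ , p) | inj₂ (q , z) | r =
  <⇒≱ 2≤k (≤-reflexive (trans (≡-sym q) (trans p (cong suc (trans (≡-sym r) z)))))
... | inj₂ (p , z) | inj₁ (_ , q) | r =
  <⇒≱ 2≤k (≤-reflexive (trans (≡-sym p) (trans (≡-sym r) (trans q (cong suc z)))))
... | inj₂ (_ , z) | inj₂ (q , _) | _ =
  <⇒≱ 2≤k (≤-trans (≤-reflexive (trans (≡-sym q) z)) z≤n)

-- A rooted tree presented by parent pointers: `parent a` is the parent of a,
-- `root` is the only vertex without one, and depth grows by one from parent
-- to child.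
module ParentTree {m} (parent : Fin m → Maybe (Fin m)) (depth : Fin m → ℕ)
  (depth-parent : ∀ {a b} → parent a ≡ just b → depth a ≡ suc (depth b))
  (root : Fin m) (root-only : ∀ {a} → parent a ≡ nothing → a ≡ root) (depth-root : depth root ≡ 0)
  where

  isParent : Fin m → Fin m → Bool
  isParent a b = does (≡-dec _≟_ (parent a) (just b))

  parent≢self : ∀ a → parent a ≢ just a
  parent≢self a pa = 1+n≢n (≡-sym (depth-parent pa))

  tree : Graph m
  tree = record
    { adj = λ a b → isParent a b ∨ isParent b a
    ; sym = λ a b → ∨-comm (isParent a b) (isParent b a)
    ; irrefl = λ a →
        cong (λ p → p ∨ p) (dec-false (≡-dec _≟_ (parent a) (just a)) (parent≢self a)) }

  parent⇒adj : ∀ {a b} → parent a ≡ just b → adj tree a b ≡ true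
  parent⇒adj {a} {b} pa rewrite dec-true (≡-dec _≟_ (parent a) (just b)) pa = refl

  adj⇒parent : ∀ {a b} → adj tree a b ≡ true → parent a ≡ just b ⊎ parent b ≡ just a
  adj⇒parent {a} {b} ab with ≡-dec _≟_ (parent a) (just b) | ≡-dec _≟_ (parent b) (just a)
  ... | yes pa | _ = inj₁ pa
  ... | no _ | yes pb = inj₂ pb
  ... | no _ | no _ = ⊥-elim (true≢false (≡-sym ab))

  adj-down : ∀ {a b} → adj tree a b ≡ true → depth b ≤ depth a → parent a ≡ just b
  adj-down {a} ab b≤a with adj⇒parent ab
  ... | inj₁ pa = pa
  ... | inj₂ pb = ⊥-elim (1+n≰n (subst (_≤ depth a) (depth-parent pb) b≤a))

  -- The child and the parent of a vertex are distinct: their depths differ by two.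
  child≢parent : ∀ {t c p} → parent c ≡ just t → parent t ≡ just p → c ≢ p
  child≢parent {c = c} ct tp refl =
    <-irrefl (trans (depth-parent ct) (cong suc (depth-parent tp))) (m<n⇒m<1+n (n<1+n (depth c)))

  leaf-children : ∀ {t c₀ c₁} → IsLeaf tree t → parent c₀ ≡ just t → parent c₁ ≡ just t → c₀ ≡ c₁
  leaf-children {t} {c₀} {c₁} leaf p₀ p₁ =
    leaf c₀ c₁ (trans (sym tree t c₀) (parent⇒adj p₀)) (trans (sym tree t c₁) (parent⇒adj p₁))

  leaf-childless : ∀ {t c p} → IsLeaf tree t → parent t ≡ just p → parent c ≡ just t → ⊥
  leaf-childless {t} {c} {p} leaf tp ct =
    child≢parent ct tp (leaf c p (trans (sym tree t c) (parent⇒adj ct)) (parent⇒adj tp))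

  childless-leaf : ∀ {t} → (∀ c → parent c ≢ just t) → IsLeaf tree t
  childless-leaf {t} childless a b ta tb = just-injective (trans (≡-sym (up ta)) (up tb))
    where
    up : ∀ {a} → adj tree t a ≡ true → parent t ≡ just a
    up {a} ta with adj⇒parent ta
    ... | inj₁ tp = tp
    ... | inj₂ at = ⊥-elim (childless a at)

  climb : ∀ a → Walk tree a root (depth a)
  climb a = climb-from (depth a) a refl
    where
    climb-from : ∀ k a → depth a ≡ k → Walk tree a root k
    climb-from k a da with parent a in pa
    climb-from k a da | nothing rewrite root-only pa =
      subst (Walk tree root root) (trans (≡-sym depth-root) da) here
    climb-from zero a da | just b = ⊥-elim (1+n≢0 (trans (≡-sym (depth-parent pa)) da))
    climb-from (suc k) a da | just b =
      step (parent⇒adj pa) (climb-from k b (suc-injective (trans (≡-sym (depth-parent pa)) da)))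

  connected : Connected tree
  connected a b = depth a + depth b , climb a ++ʷ reverseʷ (climb b)

  -- On a cycle, a deepest vertex would have both cycle-neighbours as parent,
  -- forcing them to coincide; impossible when the cycle has length ≥ 3.
  acyclic : Acyclic tree
  acyclic l′ C = from-deepest (maximiser (depth ∘ v))
    where
    open Cycle C
    from-deepest : (Σ (Fin (suc l′)) λ i → ∀ k → depth (v k) ≤ depth (v i)) → ⊥
    from-deepest (i , deepest) with next-surjective i
    ... | j , refl = next-next≢ long j (inj (just-injective (trans (≡-sym via-next) via-prev)))
      where
      via-next : parent (v (next j)) ≡ just (v (next (next j)))
      via-next = adj-down (adjs (next j)) (deepest (next (next j)))
      via-prev : parent (v (next j)) ≡ just (v j)
      via-prev = adj-down (trans (sym tree (v (next j)) (v j)) (adjs j)) (deepest j)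

-- Enumeration of the dependent sum Σ (u : Fin n) Fin (size u) by Fin (total size),
-- listing the blocks Fin (size 0), Fin (size 1), … one after another.
total : ∀ {n} → (Fin n → ℕ) → ℕ
total {zero} size = 0
total {suc n} size = size zero + total (size ∘ suc)

encodeΣ : ∀ {n} (size : Fin n → ℕ) (u : Fin n) → Fin (size u) → Fin (total size)
encodeΣ size zero i = i ↑ˡ total (size ∘ suc)
encodeΣ size (suc u) i = size zero ↑ʳ encodeΣ (size ∘ suc) u i

decodeΣ : ∀ {n} (size : Fin n → ℕ) → Fin (total size) → Σ (Fin n) (Fin ∘ size)
decodeΣ {suc n} size k with splitAt (size zero) k
... | inj₁ i = zero , i
... | inj₂ k′ = Product.map suc id (decodeΣ (size ∘ suc) k′)

decodeΣ-encodeΣ : ∀ {n} (size : Fin n → ℕ) u i → decodeΣ size (encodeΣ size u i) ≡ (u , i)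
decodeΣ-encodeΣ size zero i rewrite splitAt-↑ˡ (size zero) i (total (size ∘ suc)) = refl
decodeΣ-encodeΣ size (suc u) i
  rewrite splitAt-↑ʳ (size zero) (total (size ∘ suc)) (encodeΣ (size ∘ suc) u i)
        | decodeΣ-encodeΣ (size ∘ suc) u i = refl

encodeΣ-decodeΣ : ∀ {n} (size : Fin n → ℕ) k → uncurry (encodeΣ size) (decodeΣ size k) ≡ k
encodeΣ-decodeΣ {suc n} size k
  with splitAt (size zero) k | join-splitAt (size zero) (total (size ∘ suc)) k
... | inj₁ i | joined = joined
... | inj₂ k′ | joined = trans (cong (size zero ↑ʳ_) (encodeΣ-decodeΣ (size ∘ suc) k′)) joined

-- The spider with legs of lengths len u + 1: a root and, for every u, a path
-- leg u 0 — leg u 1 — … — leg u (len u) hanging from it, ending in the tip of u.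
module Spider {n} (len : Fin n → ℕ) where

  data Vertex : Set where
    root : Vertex
    leg  : (u : Fin n) → Fin (suc (len u)) → Vertex

  tipV : Fin n → Vertex
  tipV u = leg u (fromℕ (len u))

  parentV : Vertex → Maybe Vertex
  parentV root = nothing
  parentV (leg u zero) = just root
  parentV (leg u (suc i)) = just (leg u (inject₁ i))

  depthV : Vertex → ℕ
  depthV root = 0
  depthV (leg u i) = suc (toℕ i)

  depthV-parent : ∀ {x y} → parentV x ≡ just y → depthV x ≡ suc (depthV y)
  depthV-parent {leg u zero} refl = refl
  depthV-parent {leg u (suc i)} refl = cong (2 +_) (≡-sym (toℕ-inject₁ i))

  childV : ∀ u (i : Fin (suc (len u))) → toℕ i < len u → ∃ λ c → parentV c ≡ just (leg u i)
  childV u i i<len = leg u (suc (fromℕ< i<len)) ,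
    cong (just ∘ leg u) (toℕ-injective (trans (toℕ-inject₁ _) (toℕ-fromℕ< i<len)))

  parentV-leg : ∀ u i → ∃ λ p → parentV (leg u i) ≡ just p
  parentV-leg u zero = root , refl
  parentV-leg u (suc i) = leg u (inject₁ i) , refl

  -- Tips have no child: the parent of a leg vertex still has a vertex below it.
  tip-childless : ∀ {x} u → parentV x ≢ just (tipV u)
  tip-childless {leg u′ (suc i)} u p =
    <-irrefl (≡-sym (trans (≡-sym room) (trans (cong below (just-injective p)) none)))
      (m<n⇒0<n∸m (toℕ<n i))
    where
    below : Vertex → ℕ
    below root = 0
    below (leg w j) = len w ∸ toℕ j
    room : below (leg u′ (inject₁ i)) ≡ len u′ ∸ toℕ i
    room = cong (len u′ ∸_) (toℕ-inject₁ i)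
    none : below (tipV u) ≡ 0
    none = trans (cong (len u ∸_) (toℕ-fromℕ (len u))) (n∸n≡0 (len u))

  tipV-injective : ∀ {u v} → tipV u ≡ tipV v → u ≡ v
  tipV-injective refl = refl

  m : ℕ
  m = suc (total (suc ∘ len))

  encode : Vertex → Fin m
  encode root = zero
  encode (leg u i) = suc (encodeΣ (suc ∘ len) u i)

  decode : Fin m → Vertex
  decode zero = root
  decode (suc k) = uncurry leg (decodeΣ (suc ∘ len) k)

  decode-encode : ∀ x → decode (encode x) ≡ x
  decode-encode root = refl
  decode-encode (leg u i) = cong (uncurry leg) (decodeΣ-encodeΣ (suc ∘ len) u i)

  encode-decode : ∀ k → encode (decode k) ≡ k
  encode-decode zero = refl
  encode-decode (suc k) = cong suc (encodeΣ-decodeΣ (suc ∘ len) k)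

  encode-injective : ∀ {x y} → encode x ≡ encode y → x ≡ y
  encode-injective {x} {y} e =
    trans (≡-sym (decode-encode x)) (trans (cong decode e) (decode-encode y))

  parent : Fin m → Maybe (Fin m)
  parent = Maybe.map encode ∘ parentV ∘ decode

  depth : Fin m → ℕ
  depth = depthV ∘ decode

  parent-decode : ∀ {a b} → parent a ≡ just b → parentV (decode a) ≡ just (decode b)
  parent-decode {a} pa with parentV (decode a)
  parent-decode () | nothing
  parent-decode pa | just y =
    cong just (trans (≡-sym (decode-encode y)) (cong decode (just-injective pa)))

  parent-encode : ∀ {x y} → parentV x ≡ just y → parent (encode x) ≡ just (encode y)
  parent-encode {x} p rewrite decode-encode x | p = refl

  root-only : ∀ {a} → parent a ≡ nothing → a ≡ encode root
  root-only {a} pa = trans (≡-sym (encode-decode a)) (cong encode (orphan (decode a) pa))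
    where
    orphan : ∀ x → Maybe.map encode (parentV x) ≡ nothing → x ≡ root
    orphan root _ = refl
    orphan (leg u zero) ()
    orphan (leg u (suc i)) ()

  open ParentTree parent depth (depthV-parent ∘ parent-decode) (encode root) root-only refl
    public

  tip : Fin n → Fin m
  tip = encode ∘ tipV

  tip-injective : Injective _≡_ _≡_ tip
  tip-injective = tipV-injective ∘ encode-injective

  -- The leaves of the spider are exactly the tips (as soon as it has two legs).
  leaves : ∀ {u₀ u₁} → u₀ ≢ u₁ → ∀ t → IsLeaf tree t ⇔ ∃ λ u → tip u ≡ t
  leaves {u₀} {u₁} u₀≢u₁ t = mk⇔ to from
    where
    leaf-is-tip : ∀ x → IsLeaf tree (encode x) → ∃ λ u → tipV u ≡ x
    leaf-is-tip root leaf = ⊥-elim (u₀≢u₁ (owners (encode-injective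
      (leaf-children leaf (parent-encode {leg u₀ zero} refl) (parent-encode {leg u₁ zero} refl)))))
      where
      owners : leg u₀ zero ≡ leg u₁ zero → u₀ ≡ u₁
      owners refl = refl
    leaf-is-tip (leg u i) leaf with m≤n⇒m<n∨m≡n (≤-pred (toℕ<n i))
    ... | inj₂ i≡len = u , cong (leg u) (toℕ-injective (trans (toℕ-fromℕ (len u)) (≡-sym i≡len)))
    ... | inj₁ i<len with parentV-leg u i | childV u i i<len
    ...   | _ , has-parent | c , has-child =
      ⊥-elim (leaf-childless {c = encode c} leaf
        (parent-encode {leg u i} has-parent) (parent-encode {c} has-child))
    to : IsLeaf tree t → ∃ λ u → tip u ≡ t
    to leaf with leaf-is-tip (decode t) (subst (IsLeaf tree) (≡-sym (encode-decode t)) leaf)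
    ... | u , tipV≡ = u , trans (cong encode tipV≡) (encode-decode t)
    from : (∃ λ u → tip u ≡ t) → IsLeaf tree t
    from (u , refl) = childless-leaf λ c pc →
      tip-childless u
        (subst (λ y → parentV (decode c) ≡ just y) (decode-encode (tipV u)) (parent-decode pc))

  -- Distance from a vertex to the tip of leg v.
  toTip : Fin n → Vertex → ℕ
  toTip v root = suc (len v)
  toTip v (leg u i) = if does (u ≟ v) then len v ∸ toℕ i else suc (toℕ i) + suc (len v)

  toTip-parent : ∀ v {x y} → parentV x ≡ just y →
    toTip v y ≡ suc (toTip v x) ⊎ toTip v x ≡ suc (toTip v y)
  toTip-parent v {leg u zero} refl with u ≟ v
  ... | yes refl = inj₁ refl
  ... | no _ = inj₂ refl
  toTip-parent v {leg u (suc i)} refl with u ≟ v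
  ... | yes refl = inj₁ (trans (cong (len u ∸_) (toℕ-inject₁ i)) (+-∸-assoc 1 (toℕ<n i)))
  ... | no _ = inj₂ (cong (λ d → 2 + d + suc (len v)) (≡-sym (toℕ-inject₁ i)))

  within-one : ∀ {x y} → y ≡ suc x ⊎ x ≡ suc y → x ≤ suc y
  within-one (inj₁ refl) = ≤-trans (n≤1+n _) (n≤1+n _)
  within-one (inj₂ refl) = ≤-refl

  toTip-step : ∀ v a b → adj tree a b ≡ true → toTip v (decode a) ≤ suc (toTip v (decode b))
  toTip-step v a b ab with adj⇒parent {a} {b} ab
  ... | inj₁ pa = within-one (toTip-parent v (parent-decode {a} pa))
  ... | inj₂ pb = within-one (Sum.swap (toTip-parent v (parent-decode {b} pb)))

  toTip-self : ∀ v → toTip v (tipV v) ≡ 0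
  toTip-self v rewrite dec-true (v ≟ v) refl | toℕ-fromℕ (len v) = n∸n≡0 (len v)

  toTip-other : ∀ {u v} → u ≢ v → toTip v (tipV u) ≡ suc (len u) + suc (len v)
  toTip-other {u} {v} u≢v rewrite dec-false (u ≟ v) u≢v | toℕ-fromℕ (len u) = refl

  depth-tip : ∀ u → depth (tip u) ≡ suc (len u)
  depth-tip u = trans (cong depthV (decode-encode (tipV u))) (cong suc (toℕ-fromℕ (len u)))

  -- Distinct tips u, v are at distance exactly (len u + 1) + (len v + 1):
  -- the path through the root realises it, and toTip v bounds it from below.
  tip-distance : ∀ {u v} → u ≢ v → ∀ k →
    DistLe tree (tip u) (tip v) k ⇔ (suc (len u) + suc (len v) ≤ k)
  tip-distance {u} {v} u≢v k = mk⇔ to from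
    where
    to : DistLe tree (tip u) (tip v) k → suc (len u) + suc (len v) ≤ k
    to (ℓ , ℓ≤k , w) = begin
      suc (len u) + suc (len v)       ≡⟨ toTip-other u≢v ⟨
      toTip v (tipV u)                ≡⟨ cong (toTip v) (decode-encode (tipV u)) ⟨
      toTip v (decode (tip u))        ≤⟨ potential-bound tree (toTip v ∘ decode) (toTip-step v) w ⟩
      ℓ + toTip v (decode (tip v))    ≡⟨ cong (λ x → ℓ + toTip v x) (decode-encode (tipV v)) ⟩
      ℓ + toTip v (tipV v)            ≡⟨ cong (ℓ +_) (toTip-self v) ⟩
      ℓ + 0                           ≡⟨ +-identityʳ ℓ ⟩
      ℓ                               ≤⟨ ℓ≤k ⟩
      k                               ∎
      where open ≤-Reasoning
    from : suc (len u) + suc (len v) ≤ k → DistLe tree (tip u) (tip v) k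
    from le = _ , le , subst (Walk tree (tip u) (tip v)) (cong₂ _+_ (depth-tip u) (depth-tip v))
      (climb (tip u) ++ʷ reverseʷ (climb (tip v)))

trivial-leaf-power : ∀ {n} (G : Graph n) → (∀ (a b : Fin n) → a ≡ b) → IsLeafPower G
trivial-leaf-power {n} G all-equal =
  n , edgeless , id , (connected , acyclic) , id , leaves , 1 , s≤s z≤n ,
  λ u v u≢v → ⊥-elim (u≢v (all-equal u v))
  where
  edgeless : Graph n
  edgeless = record { adj = λ _ _ → false ; sym = λ _ _ → refl ; irrefl = λ _ → refl }
  connected : Connected edgeless
  connected a b = 0 , subst (λ c → Walk edgeless a c 0) (all-equal a b) here
  acyclic : Acyclic edgeless
  acyclic l′ C = true≢false (≡-sym (Cycle.adjs C zero))
  leaves : ∀ t → IsLeaf edgeless t ⇔ ∃ λ u → u ≡ t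
  leaves t = mk⇔ (λ _ → t , refl) (λ _ a b ())

shift-by-one : ∀ a b t → (a + b ≤ t) ⇔ (suc a + suc b ≤ suc (suc t))
shift-by-one a b t rewrite +-suc a b = mk⇔ (s≤s ∘ s≤s) (≤-pred ∘ ≤-pred)

threshold-leaf-power : ∀ {k} (G : Graph (suc (suc k))) → Threshold G → IsLeafPower G
threshold-leaf-power G R =
  m , tree , tip , (connected , acyclic) , tip-injective , leaves {zero} {suc zero} (λ ()) ,
  suc (suc bound) , s≤s z≤n ,
  λ u v u≢v → ⇔-trans (adjacency u v u≢v)
    (⇔-trans (shift-by-one (weight u) (weight v) bound)
             (⇔-sym (tip-distance u≢v (suc (suc bound)))))
  where
  open Threshold R
  open Spider weight

proposition2 : ∀ (n : ℕ) (G : Graph n) → ¬ HasAlternatingCycle G → IsLeafPower G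
proposition2 zero G _ = trivial-leaf-power G λ ()
proposition2 (suc zero) G _ = trivial-leaf-power G λ { zero zero → refl }
proposition2 n@(suc (suc _)) G no-cycle = threshold-leaf-power G (threshold n G (nested G no-cycle))
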